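{- For all integers $1\le k\le n$, the following two sets have the same number of elements: (1) the set of Dyck paths of semilength $n-1$ whose hills are each colored with one of two colors, exactly $n-k$ of the hills having color $2$; (2) the set of binary words of length $n+k-2$ having $n-1$ ones and $k-1$ zeros such that no initial segment contains more zeros than ones.
   Context: A Dyck path of semilength $r$ is a lattice path from $(0,0)$ to $(2r,0)$ with steps $(1,1)$, $(1,-1)$ never going below the $x$-axis; a hill is an up step starting on the $x$-axis immediately followed by a down step returning to the $x$-axis. -}

module Defs where

open import Data.Bool using (Bool; true; false; T; _∧_)
open import Data.Nat using (ℕ; zero; suc; _+_; _*_; _∸_; _≡ᵇ_)
open import Data.List using (List; []; _∷_; length)
open import Data.Vec using (Vec)
open import Data.Product using (Σ; _×_)
open import Relation.Binary.PropositionalEquality using (_≡_)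

-- A step of a lattice path: true = up step (1,1), false = down step (1,-1).
Step : Set
Step = Bool

stays : ℕ → List Step → Bool
stays zero    []            = true
stays (suc h) []            = false
stays h       (true  ∷ s)   = stays (suc h) s
stays zero    (false ∷ s)   = false
stays (suc h) (false ∷ s)   = stays h s

IsDyck : ℕ → List Step → Set
IsDyck r s = (length s ≡ 2 * r) × T (stays 0 s)

hillsFrom : ℕ → List Step → ℕ
hillsFrom h       []                    = 0
hillsFrom zero    (true ∷ false ∷ s)    = suc (hillsFrom zero s)
hillsFrom h       (true ∷ s)            = hillsFrom (suc h) s
hillsFrom zero    (false ∷ s)           = hillsFrom zero s
hillsFrom (suc h) (false ∷ s)           = hillsFrom h s

hills : List Step → ℕ
hills = hillsFrom 0

countTrue : {n : ℕ} → Vec Bool n → ℕ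
countTrue Data.Vec.[] = 0
countTrue (true  Data.Vec.∷ v) = suc (countTrue v)
countTrue (false Data.Vec.∷ v) = countTrue v

-- Set (1): Dyck paths of semilength n-1 together with a 2-colouring of
-- their hills (the i-th hill, from left to right, gets colour 2 iff the
-- i-th entry of the colouring vector is true), with exactly n-k hills of
-- colour 2.
ColouredDyck : ℕ → ℕ → Set
ColouredDyck n k =
  Σ (List Step) λ s → IsDyck (n ∸ 1) s ×
    Σ (Vec Bool (hills s)) λ c → countTrue c ≡ n ∸ k

ones : List Bool → ℕ
ones []          = 0
ones (true ∷ w)  = suc (ones w)
ones (false ∷ w) = ones w

zeros : List Bool → ℕ
zeros []          = 0
zeros (true ∷ w)  = zeros w
zeros (false ∷ w) = suc (zeros w)

ballot : ℕ → List Bool → Bool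
ballot d       []          = true
ballot d       (true ∷ w)  = ballot (suc d) w
ballot zero    (false ∷ w) = false
ballot (suc d) (false ∷ w) = ballot d w

BallotWord : ℕ → ℕ → Set
BallotWord n k =
  Σ (List Bool) λ w →
    (length w ≡ n + k ∸ 2) × (ones w ≡ n ∸ 1) × (zeros w ≡ k ∸ 1) ×
    T (ballot 0 w)

module Submission where

-- A coloured Dyck path becomes a ballot word by writing 1 for each up step
-- and 0 for each down step, except that the down step of every hill of
-- colour 2 is dropped.  The ones count the semilength n-1, the zeros count
-- n-1 minus the number n-k of hills of colour 2, and every prefix keeps at
-- least as many ones as zeros because its surplus is at least the height of
-- the path.  Conversely a ballot word is decoded from right to left: a 0 is
-- a down step, and a 1 is an up step unless the part decoded so far starts
-- on the axis, in which case it is a hill of colour 2.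

open import Defs
open import Data.Nat using (ℕ; zero; suc; _+_; _*_; _∸_; _≤_; z≤n; s≤s)
open import Data.Nat.Properties
  using (≡-irrelevant; +-suc; +-identityʳ; +-cancelʳ-≡; *-cancelˡ-≡; m+n∸m≡n; m+[n∸m]≡n)
open import Data.Bool using (Bool; true; false; T)
open import Data.Bool.Properties using (T-irrelevant)
open import Data.List using (List; []; _∷_; length)
open import Data.Vec using (Vec; []; _∷_)
open import Data.Product using (Σ; _,_; proj₁)
open import Function.Bundles using (_↔_; mk↔ₛ′)
open import Relation.Binary.PropositionalEquality
  using (_≡_; refl; sym; trans; cong; cong₂; subst; module ≡-Reasoning)

length≡ones+zeros : ∀ w → length w ≡ ones w + zeros w
length≡ones+zeros []          = refl
length≡ones+zeros (true ∷ w)  = cong suc (length≡ones+zeros w)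
length≡ones+zeros (false ∷ w) =
  trans (cong suc (length≡ones+zeros w)) (sym (+-suc (ones w) (zeros w)))

stays⇒ones+h≡zeros : ∀ h s → T (stays h s) → ones s + h ≡ zeros s
stays⇒ones+h≡zeros zero    []          _ = refl
stays⇒ones+h≡zeros zero    (true ∷ s)  p = trans (sym (+-suc (ones s) 0)) (stays⇒ones+h≡zeros 1 s p)
stays⇒ones+h≡zeros (suc h) (true ∷ s)  p =
  trans (sym (+-suc (ones s) (suc h))) (stays⇒ones+h≡zeros (suc (suc h)) s p)
stays⇒ones+h≡zeros (suc h) (false ∷ s) p = trans (+-suc (ones s) h) (cong suc (stays⇒ones+h≡zeros h s p))

stays⇒ones≡zeros : ∀ s → T (stays 0 s) → ones s ≡ zeros s
stays⇒ones≡zeros s p = trans (sym (+-identityʳ (ones s))) (stays⇒ones+h≡zeros 0 s p)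

stays⇒length≡2*ones : ∀ s → T (stays 0 s) → length s ≡ 2 * ones s
stays⇒length≡2*ones s p = begin
  length s                  ≡⟨ length≡ones+zeros s ⟩
  ones s + zeros s          ≡⟨ cong (ones s +_) (sym (stays⇒ones≡zeros s p)) ⟩
  ones s + ones s           ≡⟨ cong (ones s +_) (sym (+-identityʳ (ones s))) ⟩
  2 * ones s                ∎
  where open ≡-Reasoning

encode : ∀ h s → Vec Bool (hillsFrom h s) → List Bool
encode h       []                 c           = []
encode zero    (true ∷ false ∷ s) (true ∷ c)  = true ∷ encode zero s c
encode zero    (true ∷ false ∷ s) (false ∷ c) = true ∷ false ∷ encode zero s c
encode zero    (true ∷ [])        c           = true ∷ encode 1 [] c
encode zero    (true ∷ true ∷ s)  c           = true ∷ encode 1 (true ∷ s) c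
encode (suc h) (true ∷ s)         c           = true ∷ encode (suc (suc h)) s c
encode zero    (false ∷ s)        c           = false ∷ encode zero s c
encode (suc h) (false ∷ s)        c           = false ∷ encode h s c

ones-encode : ∀ h s c → ones (encode h s c) ≡ ones s
ones-encode h       []                 c           = refl
ones-encode zero    (true ∷ false ∷ s) (true ∷ c)  = cong suc (ones-encode zero s c)
ones-encode zero    (true ∷ false ∷ s) (false ∷ c) = cong suc (ones-encode zero s c)
ones-encode zero    (true ∷ [])        []          = refl
ones-encode zero    (true ∷ true ∷ s)  c           = cong suc (ones-encode 1 (true ∷ s) c)
ones-encode (suc h) (true ∷ s)         c           = cong suc (ones-encode (suc (suc h)) s c)
ones-encode zero    (false ∷ s)        c           = ones-encode zero s c
ones-encode (suc h) (false ∷ s)        c           = ones-encode h s c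

zeros-encode+countTrue : ∀ h s c → zeros (encode h s c) + countTrue c ≡ zeros s
zeros-encode+countTrue h       []                 []          = refl
zeros-encode+countTrue zero    (true ∷ false ∷ s) (true ∷ c)  =
  trans (+-suc _ _) (cong suc (zeros-encode+countTrue zero s c))
zeros-encode+countTrue zero    (true ∷ false ∷ s) (false ∷ c) = cong suc (zeros-encode+countTrue zero s c)
zeros-encode+countTrue zero    (true ∷ [])        []          = refl
zeros-encode+countTrue zero    (true ∷ true ∷ s)  c           = zeros-encode+countTrue 1 (true ∷ s) c
zeros-encode+countTrue (suc h) (true ∷ s)         c           = zeros-encode+countTrue (suc (suc h)) s c
zeros-encode+countTrue zero    (false ∷ s)        c           = cong suc (zeros-encode+countTrue zero s c)
zeros-encode+countTrue (suc h) (false ∷ s)        c           = cong suc (zeros-encode+countTrue h s c)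

encode-ballot : ∀ h s c d → T (stays h s) → h ≤ d → T (ballot d (encode h s c))
encode-ballot h       []                 c           d       p _         = _
encode-ballot zero    (true ∷ false ∷ s) (true ∷ c)  d       p _         = encode-ballot zero s c (suc d) p z≤n
encode-ballot zero    (true ∷ false ∷ s) (false ∷ c) d       p _         = encode-ballot zero s c d p z≤n
encode-ballot zero    (true ∷ true ∷ s)  c           d       p _         =
  encode-ballot 1 (true ∷ s) c (suc d) p (s≤s z≤n)
encode-ballot (suc h) (true ∷ s)         c           d       p h≤d       =
  encode-ballot (suc (suc h)) s c (suc d) p (s≤s h≤d)
encode-ballot (suc h) (false ∷ s)        c           (suc d) p (s≤s h≤d) = encode-ballot h s c d p h≤d

record ColouredPath : Set where
  constructor coloured
  field
    start  : ℕ
    steps  : List Step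
    colour : Vec Bool (hillsFrom start steps)

open ColouredPath

encodePath : ColouredPath → List Bool
encodePath p = encode (start p) (steps p) (colour p)

-- A hill created by the new up step gets colour 1: its down step is in the word.
colourUp : ∀ h s → Vec Bool (hillsFrom (suc h) s) → Vec Bool (hillsFrom h (true ∷ s))
colourUp zero    []          c = c
colourUp zero    (true ∷ s)  c = c
colourUp zero    (false ∷ s) c = false ∷ c
colourUp (suc h) s           c = c

consOne : ColouredPath → ColouredPath
consOne (coloured zero    s c) = coloured zero (true ∷ false ∷ s) (true ∷ c)
consOne (coloured (suc h) s c) = coloured h (true ∷ s) (colourUp h s c)

consZero : ColouredPath → ColouredPath
consZero (coloured h s c) = coloured (suc h) (false ∷ s) c

decode : List Bool → ColouredPath
decode []          = coloured 0 [] []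
decode (true ∷ w)  = consOne (decode w)
decode (false ∷ w) = consZero (decode w)

encode-colourUp : ∀ h s c → encode h (true ∷ s) (colourUp h s c) ≡ true ∷ encode (suc h) s c
encode-colourUp zero    []          c = refl
encode-colourUp zero    (true ∷ s)  c = refl
encode-colourUp zero    (false ∷ s) c = refl
encode-colourUp (suc h) s           c = refl

encode-decode : ∀ w → encodePath (decode w) ≡ w
encode-decode []          = refl
encode-decode (true ∷ w) with decode w | encode-decode w
... | coloured zero    s c | refl = refl
... | coloured (suc h) s c | refl = encode-colourUp h s c
encode-decode (false ∷ w) = cong (false ∷_) (encode-decode w)

decode-encode : ∀ h s c → T (stays h s) → decode (encode h s c) ≡ coloured h s c
decode-encode zero    []                 []          p = refl
decode-encode zero    (true ∷ false ∷ s) (true ∷ c)  p rewrite decode-encode zero s c p = refl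
decode-encode zero    (true ∷ false ∷ s) (false ∷ c) p rewrite decode-encode zero s c p = refl
decode-encode zero    (true ∷ true ∷ s)  c           p rewrite decode-encode 2 s c p = refl
decode-encode (suc h) (true ∷ s)         c           p rewrite decode-encode (suc (suc h)) s c p = refl
decode-encode (suc h) (false ∷ s)        c           p rewrite decode-encode h s c p = refl

decode-stays : ∀ w → T (stays (start (decode w)) (steps (decode w)))
decode-stays []          = _
decode-stays (true ∷ w) with decode w | decode-stays w
... | coloured zero          s c | p = p
... | coloured (suc zero)    s c | p = p
... | coloured (suc (suc h)) s c | p = p
decode-stays (false ∷ w) = decode-stays w

ballot⇒start-decode≤ : ∀ w d → T (ballot d w) → start (decode w) ≤ d
ballot⇒start-decode≤ []          d       p = z≤n
ballot⇒start-decode≤ (true ∷ w)  d       p with decode w | ballot⇒start-decode≤ w (suc d) p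
... | coloured zero    s c | _       = z≤n
... | coloured (suc h) s c | s≤s h≤d = h≤d
ballot⇒start-decode≤ (false ∷ w) (suc d) p = s≤s (ballot⇒start-decode≤ w d p)

ColouredDyckPath : Set
ColouredDyckPath = Σ (List Step) λ s → Vec Bool (hills s)

decode-ballot : ∀ w → T (ballot 0 w) → Σ ColouredDyckPath λ (s , c) → decode w ≡ coloured 0 s c
decode-ballot w b with decode w | ballot⇒start-decode≤ w 0 b
... | coloured zero s c | _ = (s , c) , refl

coloured-injective : ∀ {s s' c c'} → coloured 0 s c ≡ coloured 0 s' c' →
                     _≡_ {A = ColouredDyckPath} (s , c) (s' , c')
coloured-injective refl = refl

underlyingPath : ∀ {n k} → ColouredDyck n k → ColouredDyckPath
underlyingPath (s , _ , c , _) = s , c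

underlyingPath-injective : ∀ {n k} (x y : ColouredDyck n k) →
                           underlyingPath {n} {k} x ≡ underlyingPath {n} {k} y → x ≡ y
underlyingPath-injective (s , (l , d) , c , q) (.s , (l' , d') , .c , q') refl
  rewrite ≡-irrelevant l l' | T-irrelevant d d' | ≡-irrelevant q q' = refl

ballotWord-injective : ∀ {n k} (x y : BallotWord n k) → proj₁ x ≡ proj₁ y → x ≡ y
ballotWord-injective (w , l , o , z , b) (.w , l' , o' , z' , b') refl
  rewrite ≡-irrelevant l l' | ≡-irrelevant o o' | ≡-irrelevant z z' | T-irrelevant b b' = refl

module _ {m j : ℕ} (j≤m : j ≤ m) where

  toBallot : ColouredDyck (suc m) (suc j) → BallotWord (suc m) (suc j)
  toBallot (s , (len , dyck) , c , cnt) = w , length-w , ones-w , zeros-w , encode-ballot 0 s c 0 dyck z≤n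
    where
    w = encode 0 s c
    ones-s : ones s ≡ m
    ones-s = *-cancelˡ-≡ (ones s) m 2 (trans (sym (stays⇒length≡2*ones s dyck)) len)
    ones-w : ones w ≡ m
    ones-w = trans (ones-encode 0 s c) ones-s
    zeros-w : zeros w ≡ j
    zeros-w = +-cancelʳ-≡ (m ∸ j) (zeros w) j (begin
      zeros w + (m ∸ j)      ≡⟨ cong (zeros w +_) (sym cnt) ⟩
      zeros w + countTrue c  ≡⟨ zeros-encode+countTrue 0 s c ⟩
      zeros s                ≡⟨ sym (stays⇒ones≡zeros s dyck) ⟩
      ones s                 ≡⟨ ones-s ⟩
      m                      ≡⟨ sym (m+[n∸m]≡n j≤m) ⟩
      j + (m ∸ j)            ∎)
      where open ≡-Reasoning
    length-w : length w ≡ suc m + suc j ∸ 2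
    length-w =
      trans (length≡ones+zeros w) (trans (cong₂ _+_ ones-w zeros-w) (cong (_∸ 1) (sym (+-suc m j))))

  fromBallot : BallotWord (suc m) (suc j) → ColouredDyck (suc m) (suc j)
  fromBallot (w , _ , ones-w , zeros-w , b) with decode-ballot w b
  ... | (s , c) , decoded = s , (len , dyck) , c , cnt
    where
    encoded : encode 0 s c ≡ w
    encoded = trans (cong encodePath (sym decoded)) (encode-decode w)
    dyck : T (stays 0 s)
    dyck = subst (λ p → T (stays (start p) (steps p))) decoded (decode-stays w)
    ones-s : ones s ≡ m
    ones-s = trans (sym (ones-encode 0 s c)) (trans (cong ones encoded) ones-w)
    len : length s ≡ 2 * m
    len = trans (stays⇒length≡2*ones s dyck) (cong (2 *_) ones-s)
    cnt : countTrue c ≡ m ∸ j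
    cnt = begin
      countTrue c                    ≡⟨ sym (m+n∸m≡n j (countTrue c)) ⟩
      j + countTrue c ∸ j
        ≡⟨ cong (λ z → z + countTrue c ∸ j) (trans (sym zeros-w) (cong zeros (sym encoded))) ⟩
      zeros (encode 0 s c) + countTrue c ∸ j
        ≡⟨ cong (_∸ j) (zeros-encode+countTrue 0 s c) ⟩
      zeros s ∸ j                    ≡⟨ cong (_∸ j) (trans (sym (stays⇒ones≡zeros s dyck)) ones-s) ⟩
      m ∸ j                          ∎
      where open ≡-Reasoning

  toBallot-fromBallot : ∀ y → toBallot (fromBallot y) ≡ y
  toBallot-fromBallot y@(w , _ , _ , _ , b) with decode-ballot w b
  ... | (s , c) , decoded =
    ballotWord-injective {suc m} {suc j} _ y (trans (cong encodePath (sym decoded)) (encode-decode w))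

  fromBallot-toBallot : ∀ x → fromBallot (toBallot x) ≡ x
  fromBallot-toBallot x@(s , (_ , dyck) , c , _)
    with decode-ballot (encode 0 s c) (encode-ballot 0 s c 0 dyck z≤n)
  ... | _ , decoded = underlyingPath-injective {suc m} {suc j} _ x
                        (coloured-injective (trans (sym decoded) (decode-encode 0 s c dyck)))

mainTheorem11 : (n k : ℕ) → 1 ≤ k → k ≤ n → ColouredDyck n k ↔ BallotWord n k
mainTheorem11 (suc m) (suc j) _ (s≤s j≤m) =
  mk↔ₛ′ (toBallot j≤m) (fromBallot j≤m) (toBallot-fromBallot j≤m) (fromBallot-toBallot j≤m)
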